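{- For any simple graph $G$, $\mathrm{lchr}(\mathcal{N}(G))\ge\chi(G)$, where $\chi(G)$ is the vertex chromatic number of $G$.
   Context: For a simple graph $G=(V,E)$, $\mathcal{N}(G)$ is the simplicial complex on $V$ whose simplices are the subsets of $V$ having a common neighbor. For a simplicial complex with vertex set $V$ and $\kappa\colon V\to[k]=\{1,\dots,k\}$, $S_\kappa(t)=|\{v\in S:\kappa(v)=t\}|$; a $k$-linear coloring is a surjective $\kappa$ with $\sum_t\min(F_\kappa(t),F'_\kappa(t))=|F\cap F'|$ for all facets (maximal faces) $F,F'$. $\mathrm{lchr}$ is the least $k$ admitting a $k$-linear coloring. -}

module Defs where

open import Data.Nat using (ℕ; _≤_; _⊓_)
open import Data.Bool using (Bool; true; false)
open import Data.Fin using (Fin; _≟_)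
open import Data.Fin.Subset using (Subset; _∈_; _⊆_; _∩_; ∣_∣)
open import Data.Vec using (tabulate; sum)
open import Data.Product using (Σ; ∃; _×_)
open import Relation.Binary.PropositionalEquality using (_≡_; _≢_)
open import Relation.Nullary.Decidable using (⌊_⌋)

record Graph (n : ℕ) : Set where
  field
    adj   : Fin n → Fin n → Bool
    sym   : ∀ u v → adj u v ≡ adj v u
    irrefl : ∀ v → adj v v ≡ false
open Graph public

-- Faces of the neighborhood complex 𝒩(G): subsets of V with a common neighbor.
IsFace : ∀ {n} → Graph n → Subset n → Set
IsFace G S = ∃ λ w → ∀ v → v ∈ S → adj G v w ≡ true

IsFacet : ∀ {n} → Graph n → Subset n → Set
IsFacet G F = IsFace G F × (∀ S → IsFace G S → F ⊆ S → S ≡ F)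

countColor : ∀ {n k} → (Fin n → Fin k) → Subset n → Fin k → ℕ
countColor κ S t = ∣ S ∩ tabulate (λ v → ⌊ κ v ≟ t ⌋) ∣

Surjective : ∀ {n k} → (Fin n → Fin k) → Set
Surjective {n} κ = ∀ t → ∃ λ (v : Fin n) → κ v ≡ t

IsLinearColoring : ∀ {n} (G : Graph n) (k : ℕ) → (Fin n → Fin k) → Set
IsLinearColoring {n} G k κ =
  Surjective κ ×
  (∀ F F′ → IsFacet G F → IsFacet G F′ →
     sum (tabulate (λ t → countColor κ F t ⊓ countColor κ F′ t)) ≡ ∣ F ∩ F′ ∣)

HasLinearColoring : ∀ {n} → Graph n → ℕ → Set
HasLinearColoring {n} G k = ∃ λ (κ : Fin n → Fin k) → IsLinearColoring G k κ

IsLchr : ∀ {n} → Graph n → ℕ → Set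
IsLchr G l = HasLinearColoring G l × (∀ k → HasLinearColoring G k → l ≤ k)

IsProperColoring : ∀ {n} (G : Graph n) (k : ℕ) → (Fin n → Fin k) → Set
IsProperColoring G k c = ∀ u v → adj G u v ≡ true → c u ≢ c v

Colorable : ∀ {n} → Graph n → ℕ → Set
Colorable {n} G k = ∃ λ (c : Fin n → Fin k) → IsProperColoring G k c

IsChromaticNumber : ∀ {n} → Graph n → ℕ → Set
IsChromaticNumber G c = Colorable G c × (∀ k → Colorable G k → c ≤ k)

-- If u ∼ v and κ u = κ v, choose facets F ⊇ N(v) and F′ ⊇ N(u) of 𝒩(G).  Then u ∈ F ∖ F′ and
-- v ∈ F′ ∖ F (no facet containing N(v) contains v, as G has no loops), so in the colour class of
-- κ u the intersection F ∩ F′ is strictly smaller than both F and F′.  Summing over colours,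
-- |F ∩ F′| < ∑ₜ min(F_κ(t), F′_κ(t)), contradicting linearity.  So every linear colouring of
-- 𝒩(G) is a proper colouring of G.
module Submission where

open import Defs hiding (sym)
open import Data.Bool using (Bool; true)
open import Data.Empty using (⊥-elim)
open import Data.Fin using (Fin; zero; suc; _≟_)
open import Data.Fin.Subset using (Subset; _∈_; _∉_; _⊆_; _⊂_; _∩_; ∣_∣; inside; outside)
open import Data.Fin.Subset.Properties
  using (_∈?_; _⊆?_; ∩-comm; p∩q⊆p; p∩q⊆q; x∈p∩q⁺; x∈p∩q⁻; p⊆q⇒∣p∣≤∣q∣; ⊆-antisym; drop-∷-⊆; drop-∷-⊂)
open import Data.List using (allFin; filter)
open import Data.List.Extrema.Nat using (argmax; argmax-all; f[xs]≤f[argmax])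
open import Data.List.Membership.Propositional.Properties using (∈-filter⁺; ∈-allFin)
open import Data.List.Relation.Unary.All using (lookup)
open import Data.List.Relation.Unary.All.Properties using (all-filter)
open import Data.Nat using (ℕ; zero; suc; _+_; _≤_; _<_; _⊓_; z≤n; s≤s)
open import Data.Nat.Properties using (<-irrefl; <⇒≱; +-mono-≤; +-mono-<-≤; +-mono-≤-<; +-suc; ⊓-glb; module ≤-Reasoning)
open import Data.Product using (∃; _×_; _,_)
open import Data.Vec using (_∷_; []; here; tabulate; sum)
open import Data.Vec.Properties using ([]=⇒lookup; lookup⇒[]=; lookup∘tabulate; tabulate-cong)
open import Function using (case_of_)
open import Relation.Binary.PropositionalEquality using (_≡_; refl; sym; trans; cong; subst; module ≡-Reasoning)
open import Relation.Nullary using (yes; no)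
open import Relation.Nullary.Decidable using (⌊_⌋; isYes≗does; dec-true)
open import Relation.Unary using (Pred; Decidable)

private
  variable
    n k : ℕ

∈-tabulate⁺ : (f : Fin n → Bool) {x : Fin n} → f x ≡ true → x ∈ tabulate f
∈-tabulate⁺ f {x} fx = lookup⇒[]= x (tabulate f) (trans (lookup∘tabulate f x) fx)

∈-tabulate⁻ : (f : Fin n → Bool) {x : Fin n} → x ∈ tabulate f → f x ≡ true
∈-tabulate⁻ f {x} x∈ = trans (sym (lookup∘tabulate f x)) ([]=⇒lookup x∈)

∩-monoˡ-⊆ : {p q r : Subset n} → p ⊆ q → p ∩ r ⊆ q ∩ r
∩-monoˡ-⊆ {p = p} {r = r} p⊆q x∈p∩r with x∈p∩q⁻ p r x∈p∩r
... | x∈p , x∈r = x∈p∩q⁺ (p⊆q x∈p , x∈r)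

p⊂q⇒∣p∣<∣q∣ : {p q : Subset n} → p ⊂ q → ∣ p ∣ < ∣ q ∣
p⊂q⇒∣p∣<∣q∣ {p = []}          {[]}          (_ , () , _)
p⊂q⇒∣p∣<∣q∣ {p = outside ∷ p} {outside ∷ q} p⊂q = p⊂q⇒∣p∣<∣q∣ (drop-∷-⊂ p⊂q)
p⊂q⇒∣p∣<∣q∣ {p = outside ∷ p} {inside ∷ q}  (p⊆q , _) = s≤s (p⊆q⇒∣p∣≤∣q∣ (drop-∷-⊆ p⊆q))
p⊂q⇒∣p∣<∣q∣ {p = inside ∷ p}  {outside ∷ q} (p⊆q , _) with p⊆q here
... | ()
p⊂q⇒∣p∣<∣q∣ {p = inside ∷ p}  {inside ∷ q}  p⊂q = s≤s (p⊂q⇒∣p∣<∣q∣ (drop-∷-⊂ p⊂q))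

p⊆q∧∣q∣≤∣p∣⇒q⊆p : {p q : Subset n} → p ⊆ q → ∣ q ∣ ≤ ∣ p ∣ → q ⊆ p
p⊆q∧∣q∣≤∣p∣⇒q⊆p {p = p} p⊆q ∣q∣≤∣p∣ {x} x∈q with x ∈? p
... | yes x∈p = x∈p
... | no  x∉p = ⊥-elim (<⇒≱ (p⊂q⇒∣p∣<∣q∣ (p⊆q , x , x∈q , x∉p)) ∣q∣≤∣p∣)

∃-argmax : ∀ {m p} {P : Pred (Fin m) p} → Decidable P → (f : Fin m → ℕ) →
           ∃ P → ∃ λ x → P x × (∀ y → P y → f y ≤ f x)
∃-argmax {m} P? f (x₀ , Px₀) =
  argmax f x₀ candidates ,
  argmax-all f Px₀ (all-filter P? (allFin m)) ,
  λ y Py → lookup (f[xs]≤f[argmax] x₀ candidates) (∈-filter⁺ P? (∈-allFin y) Py)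
  where candidates = filter P? (allFin m)

sum-tabulate-mono-≤ : {f g : Fin k → ℕ} → (∀ t → f t ≤ g t) → sum (tabulate f) ≤ sum (tabulate g)
sum-tabulate-mono-≤ {zero}  f≤g = z≤n
sum-tabulate-mono-≤ {suc k} f≤g = +-mono-≤ (f≤g zero) (sum-tabulate-mono-≤ (λ t → f≤g (suc t)))

sum-tabulate-mono-< : {f g : Fin k → ℕ} → (∀ t → f t ≤ g t) → (t₀ : Fin k) → f t₀ < g t₀ →
                      sum (tabulate f) < sum (tabulate g)
sum-tabulate-mono-< f≤g zero     f<g = +-mono-<-≤ f<g (sum-tabulate-mono-≤ (λ t → f≤g (suc t)))
sum-tabulate-mono-< f≤g (suc t₀) f<g = +-mono-≤-< (f≤g zero) (sum-tabulate-mono-< (λ t → f≤g (suc t)) t₀ f<g)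

colourClass : (Fin n → Fin k) → Fin k → Subset n
colourClass κ t = tabulate (λ x → ⌊ κ x ≟ t ⌋)

-- ⌊_⌋ is isYes, which computes only once the inner decision is in weak head normal form.
⌊suc≟suc⌋ : (c t : Fin k) → ⌊ suc c ≟ suc t ⌋ ≡ ⌊ c ≟ t ⌋
⌊suc≟suc⌋ c t with c ≟ t
... | yes _ = refl
... | no  _ = refl

sum-∣≟∷∣ : (c : Fin k) (g : Fin k → Subset n) →
           sum (tabulate (λ t → ∣ ⌊ c ≟ t ⌋ ∷ g t ∣)) ≡ suc (sum (tabulate (λ t → ∣ g t ∣)))
sum-∣≟∷∣ zero    g = refl
sum-∣≟∷∣ (suc c) g = begin
  ∣ g zero ∣ + sum (tabulate (λ t → ∣ ⌊ suc c ≟ suc t ⌋ ∷ g (suc t) ∣))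
    ≡⟨ cong (λ s → ∣ g zero ∣ + sum s)
            (tabulate-cong (λ t → cong (λ b → ∣ b ∷ g (suc t) ∣) (⌊suc≟suc⌋ c t))) ⟩
  ∣ g zero ∣ + sum (tabulate (λ t → ∣ ⌊ c ≟ t ⌋ ∷ g (suc t) ∣))
    ≡⟨ cong (∣ g zero ∣ +_) (sum-∣≟∷∣ c (λ t → g (suc t))) ⟩
  ∣ g zero ∣ + suc (sum (tabulate (λ t → ∣ g (suc t) ∣)))
    ≡⟨ +-suc _ _ ⟩
  suc (∣ g zero ∣ + sum (tabulate (λ t → ∣ g (suc t) ∣))) ∎
  where open ≡-Reasoning

∣S∣≡∑countColor : (κ : Fin n → Fin k) (S : Subset n) → ∣ S ∣ ≡ sum (tabulate (countColor κ S))
∣S∣≡∑countColor {k = k} κ []            = sym (sum-zero k)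
  where
  sum-zero : ∀ k → sum (tabulate {n = k} (λ _ → 0)) ≡ 0
  sum-zero zero    = refl
  sum-zero (suc k) = sum-zero k
∣S∣≡∑countColor κ (outside ∷ S) = ∣S∣≡∑countColor (λ x → κ (suc x)) S
∣S∣≡∑countColor κ (inside ∷ S)  =
  trans (cong suc (∣S∣≡∑countColor (λ x → κ (suc x)) S))
        (sym (sum-∣≟∷∣ (κ zero) (λ t → S ∩ colourClass (λ x → κ (suc x)) t)))

countColor-∩-≤ : (κ : Fin n → Fin k) (F F′ : Subset n) (t : Fin k) →
                 countColor κ (F ∩ F′) t ≤ countColor κ F t ⊓ countColor κ F′ t
countColor-∩-≤ κ F F′ t =
  ⊓-glb (p⊆q⇒∣p∣≤∣q∣ (∩-monoˡ-⊆ (p∩q⊆p F F′))) (p⊆q⇒∣p∣≤∣q∣ (∩-monoˡ-⊆ (p∩q⊆q F F′)))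

countColor-∩-< : (κ : Fin n → Fin k) {F F′ : Subset n} {u : Fin n} {t : Fin k} →
                 u ∈ F → u ∉ F′ → κ u ≡ t → countColor κ (F ∩ F′) t < countColor κ F t
countColor-∩-< κ {F} {F′} {u} {t} u∈F u∉F′ κu≡t =
  p⊂q⇒∣p∣<∣q∣ (∩-monoˡ-⊆ (p∩q⊆p F F′) , u , x∈p∩q⁺ (u∈F , u∈C) , u∉F∩F′∩C)
  where
  u∈C : u ∈ colourClass κ t
  u∈C = ∈-tabulate⁺ _ (trans (isYes≗does (κ u ≟ t)) (dec-true (κ u ≟ t) κu≡t))
  u∉F∩F′∩C : u ∉ (F ∩ F′) ∩ colourClass κ t
  u∉F∩F′∩C u∈ = u∉F′ (p∩q⊆q F F′ (p∩q⊆p _ _ u∈))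

∣∩∣<∑countColor⊓ : (κ : Fin n → Fin k) {F F′ : Subset n} {u v : Fin n} →
                   u ∈ F → u ∉ F′ → v ∈ F′ → v ∉ F → κ v ≡ κ u →
                   ∣ F ∩ F′ ∣ < sum (tabulate (λ t → countColor κ F t ⊓ countColor κ F′ t))
∣∩∣<∑countColor⊓ κ {F} {F′} {u} u∈F u∉F′ v∈F′ v∉F κv≡κu =
  begin-strict
    ∣ F ∩ F′ ∣                                ≡⟨ ∣S∣≡∑countColor κ (F ∩ F′) ⟩
    sum (tabulate (countColor κ (F ∩ F′)))    <⟨ sum-tabulate-mono-< (countColor-∩-≤ κ F F′) (κ u) (⊓-glb <F <F′) ⟩
    sum (tabulate (λ t → countColor κ F t ⊓ countColor κ F′ t)) ∎
  where
  open ≤-Reasoning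
  <F : countColor κ (F ∩ F′) (κ u) < countColor κ F (κ u)
  <F = countColor-∩-< κ u∈F u∉F′ refl
  <F′ : countColor κ (F ∩ F′) (κ u) < countColor κ F′ (κ u)
  <F′ = subst (λ S → countColor κ S (κ u) < _) (∩-comm F′ F) (countColor-∩-< κ v∈F′ v∉F κv≡κu)

nbhd : Graph n → Fin n → Subset n
nbhd G w = tabulate (λ x → adj G x w)

nbhd-isFace : (G : Graph n) (w : Fin n) → IsFace G (nbhd G w)
nbhd-isFace G w = w , λ x x∈N → ∈-tabulate⁻ _ x∈N

face⊆nbhd : (G : Graph n) {S : Subset n} {w : Fin n} → (∀ v → v ∈ S → adj G v w ≡ true) → S ⊆ nbhd G w
face⊆nbhd G S∼w {v} v∈S = ∈-tabulate⁺ _ (S∼w v v∈S)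

-- A face S lies in the largest neighbourhood containing it, and a largest one is a facet.
face⊆facet : (G : Graph n) {S : Subset n} → IsFace G S → ∃ λ F → IsFacet G F × S ⊆ F
face⊆facet G {S} (w₀ , S∼w₀)
  with ∃-argmax (λ w → S ⊆? nbhd G w) (λ w → ∣ nbhd G w ∣) (w₀ , face⊆nbhd G S∼w₀)
... | w , S⊆Nw , Nw-largest = nbhd G w , (nbhd-isFace G w , maximal) , S⊆Nw
  where
  maximal : ∀ T → IsFace G T → nbhd G w ⊆ T → T ≡ nbhd G w
  maximal T (u , T∼u) Nw⊆T = ⊆-antisym (λ x∈T → Nu⊆Nw (T⊆Nu x∈T)) Nw⊆T
    where
    T⊆Nu : T ⊆ nbhd G u
    T⊆Nu = face⊆nbhd G T∼u
    Nu⊆Nw : nbhd G u ⊆ nbhd G w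
    Nu⊆Nw = p⊆q∧∣q∣≤∣p∣⇒q⊆p (λ x∈Nw → T⊆Nu (Nw⊆T x∈Nw))
                            (Nw-largest u (λ x∈S → T⊆Nu (Nw⊆T (S⊆Nw x∈S))))

∉-face⊇nbhd : (G : Graph n) {F : Subset n} {v : Fin n} → IsFace G F → nbhd G v ⊆ F → v ∉ F
∉-face⊇nbhd G {v = v} (w , F∼w) Nv⊆F v∈F = case trans (sym w∼w) (irrefl G w) of λ ()
  where
  w∼w : adj G w w ≡ true
  w∼w = F∼w w (Nv⊆F (∈-tabulate⁺ _ (trans (Graph.sym G w v) (F∼w v v∈F))))

linearColoring⇒proper : (G : Graph n) (κ : Fin n → Fin k) →
                        IsLinearColoring G k κ → IsProperColoring G k κ
linearColoring⇒proper G κ (_ , linear) u v u∼v κu≡κv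
  with face⊆facet G (nbhd-isFace G v) | face⊆facet G (nbhd-isFace G u)
... | F , F-facet@(F-face , _) , Nv⊆F | F′ , F′-facet@(F′-face , _) , Nu⊆F′ =
  <-irrefl (sym (linear F F′ F-facet F′-facet))
    (∣∩∣<∑countColor⊓ κ (Nv⊆F (∈-tabulate⁺ _ u∼v)) (∉-face⊇nbhd G F′-face Nu⊆F′)
                        (Nu⊆F′ (∈-tabulate⁺ _ (trans (Graph.sym G v u) u∼v))) (∉-face⊇nbhd G F-face Nv⊆F)
                        (sym κu≡κv))

corollary8p2 : ∀ {n} (G : Graph n) (l χ : ℕ) → IsLchr G l → IsChromaticNumber G χ → χ ≤ l
corollary8p2 G l χ ((κ , κ-linear) , _) (_ , χ-least) =
  χ-least l (κ , linearColoring⇒proper G κ κ-linear)
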